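{- Let $q_1 = 2, q_2=3, \dots, q_r$ be the first $r$ primes, and let $h_1,\dots,h_r$ be integers with $1 \leq h_i \leq r/i$ for $1 \leq i \leq r$. Let $m$ be an integer with $10 < m \leq r$. Then $$ m < \sum_{i=1}^m h_i \log_2 q_i < 2r(\log_2 m)^2. $$ -}

module Defs where

open import Data.Nat using (ℕ; zero; suc; _+_; _*_; _^_; _≤_; _<_)
open import Data.Nat.Primality using (Prime)
open import Data.Product using (Σ; _×_; ∃-syntax)
open import Relation.Binary.PropositionalEquality using (_≡_)

-- q 1, …, q r are the first r primes (indices 1..r; values of q outside are irrelevant):
-- each is prime, they are strictly increasing, and every prime ≤ q r occurs among them.
FirstPrimes : (r : ℕ) → (ℕ → ℕ) → Set
FirstPrimes r q =
  (∀ i → 1 ≤ i → i ≤ r → Prime (q i)) ×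
  (∀ i j → 1 ≤ i → i < j → j ≤ r → q i < q j) ×
  (∀ p → Prime p → p ≤ q r → ∃[ i ] (1 ≤ i × i ≤ r × q i ≡ p))

-- ∏_{i=1}^{m} q_i ^ h_i ; its log₂ equals ∑_{i=1}^{m} h_i log₂ q_i
prodPow : (ℕ → ℕ) → (ℕ → ℕ) → ℕ → ℕ
prodPow q h zero    = 1
prodPow q h (suc k) = prodPow q h k * q (suc k) ^ h (suc k)

-- Real inequality  m < log₂ P , i.e. 2^m < P.
LtLog2 : ℕ → ℕ → Set
LtLog2 m P = 2 ^ m < P

-- Real inequality  log₂ P < 2 r (log₂ m)^2, written out with rational witnesses:
-- there are rationals a/b and c/d (b,d > 0) with
--   log₂ P < a/b        (P^b < 2^a),
--   c/d < log₂ m        (2^c < m^d),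
--   a/b < 2 r (c/d)^2   (a d² < 2 r c² b).
Log2LtTwiceSqLog2 : ℕ → ℕ → ℕ → Set
Log2LtTwiceSqLog2 P r m =
  ∃[ a ] ∃[ b ] ∃[ c ] ∃[ d ]
    (1 ≤ b × 1 ≤ d × P ^ b < 2 ^ a × 2 ^ c < m ^ d × a * (d * d) < 2 * r * (c * c) * b)

-- Lower bound: every factor q_i ^ h_i is at least q_i ≥ 2, and q₂ ≥ 3 makes the bound strict.
--
-- Upper bound, in three steps.
-- (1) Nair's bound: a positive common multiple of 1, …, n + 1 is at least 2 ^ n, since each
--     (n + 1) C(n,k) divides it (Nair's lemma, via 1/d₃ = 1/d₁ − 1/d₂) and ∑_k C(n,k) = 2 ^ n.
-- (2) Chebyshev-type bound q_i ≤ 2 ^ (2 ⌊log₂ i⌋ + 1): if q_i exceeded N = 2 ^ (2t + 1), every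
--     j ≤ N would be smooth over the first i − 1 primes and so divide ∏_{v < i} q_v ^ e_v ≤ N ^ (i − 1);
--     Nair's bound then gives 2 ^ (N − 1) ≤ N ^ (i − 1), which is false for i < 2 ^ (t + 1).
-- (3) Dyadic summation: log₂ P ≤ ∑ h_i (2 ⌊log₂ i⌋ + 1), and each dyadic block 2 ^ j ≤ i < 2 ^ (j + 1)
--     contributes at most r (2j + 1) because h_i ≤ r / 2 ^ j there; hence log₂ P ≤ r (J + 1)²
--     with J = ⌊log₂ m⌋ ≥ 3, which is turned into the rational form of the statement at the end.
module Submission where

open import Data.Nat using (ℕ; zero; suc; pred; _+_; _*_; _^_; _∸_; _≤_; _<_; z≤n; s≤s; z<s; _≤?_; _<?_)
open import Data.Nat using (NonZero; NonTrivial; >-nonZero; >-nonZero⁻¹; nonTrivial⇒n>1; nonTrivial⇒nonZero)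
open import Data.Nat.Properties
open import Data.Nat.Divisibility
open import Defs
open import Data.Nat.Primality using (Prime; prime⇒nonTrivial)
open import Data.Nat.Primality.Factorisation using (factorise)
open import Data.Nat.ListAction using (product)
open import Data.List using ([]; _∷_)
open import Data.List.Relation.Unary.All using (_∷_)
open import Data.Nat.Induction using (<-wellFounded)
open import Induction.WellFounded using (Acc; acc)
open import Data.Nat.Combinatorics using (_C_; nC1≡n; k>n⇒nCk≡0; nCk+nC[k+1]≡[n+1]C[k+1])
open import Data.Product using (∃-syntax; _×_; _,_; proj₁; proj₂)
open import Data.Sum using (inj₁; inj₂)
open import Relation.Nullary using (¬_; yes; no; contradiction)
open import Relation.Binary.PropositionalEquality using (_≡_; refl; sym; trans; cong; cong₂; subst; module ≡-Reasoning)
open import Data.Nat.Tactic.RingSolver using (solve-∀)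

1<2 : 1 < 2
1<2 = s≤s (s≤s z≤n)

^-cancelʳ-< : ∀ p {a b} → 1 < p → p ^ a < p ^ b → a < b
^-cancelʳ-< p {a} {b} 1<p pa<pb with a <? b
... | yes a<b = a<b
... | no a≮b = contradiction pa<pb (≤⇒≯ (^-monoʳ-≤ p {{>-nonZero (<-trans z<s 1<p)}} (≮⇒≥ a≮b)))

^-monoʳ-∣ : ∀ p {k e} → k ≤ e → p ^ k ∣ p ^ e
^-monoʳ-∣ p {k} {e} k≤e = divides (p ^ (e ∸ k)) (begin
  p ^ e               ≡⟨ cong (p ^_) (m+[n∸m]≡n k≤e) ⟨
  p ^ (k + (e ∸ k))   ≡⟨ ^-distribˡ-+-* p k (e ∸ k) ⟩
  p ^ k * p ^ (e ∸ k) ≡⟨ *-comm (p ^ k) (p ^ (e ∸ k)) ⟩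
  p ^ (e ∸ k) * p ^ k ∎)
  where open ≡-Reasoning

≤-^ : ∀ x e → 1 ≤ e → x ≤ x ^ e
≤-^ zero        (suc e) _ = z≤n
≤-^ x@(suc _)   (suc e) _ = m≤m*n x (x ^ e) {{m^n≢0 x e}}

floorLog : ∀ p → 1 < p → ∀ n → ∃[ e ] (p ^ e ≤ suc n × suc n < p ^ suc e)
floorLog p 1<p zero = 0 , ≤-refl , ≤-trans 1<p (≤-reflexive (sym (*-identityʳ p)))
floorLog p 1<p (suc n) with floorLog p 1<p n
... | e , lo , hi with suc (suc n) <? p ^ suc e
...   | yes below = e , m≤n⇒m≤1+n lo , below
...   | no notBelow = suc e , ≤-reflexive (sym onPower) , ≤-trans (s≤s (≤-reflexive onPower)) (^-monoʳ-< p 1<p (n<1+n (suc e)))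
  where
  onPower : suc (suc n) ≡ p ^ suc e
  onPower = ≤-antisym hi (≮⇒≥ notBelow)

ilog₂ : ℕ → ℕ
ilog₂ i = proj₁ (floorLog 2 1<2 (pred i))

ilog₂-lower : ∀ i → 1 ≤ i → 2 ^ ilog₂ i ≤ i
ilog₂-lower (suc i) _ = proj₁ (proj₂ (floorLog 2 1<2 i))

ilog₂-upper : ∀ i → 1 ≤ i → i < 2 ^ suc (ilog₂ i)
ilog₂-upper (suc i) _ = proj₂ (proj₂ (floorLog 2 1<2 i))

double≤pow : ∀ t → 2 * t ≤ 2 ^ t
double≤pow zero          = z≤n
double≤pow (suc zero)    = ≤-refl
double≤pow (suc (suc t)) = begin
  2 * suc (suc t)          ≡⟨ *-distribˡ-+ 2 1 (suc t) ⟩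
  2 + 2 * suc t            ≤⟨ +-mono-≤ (^-monoʳ-≤ 2 {1} {suc t} (s≤s z≤n)) (double≤pow (suc t)) ⟩
  2 ^ suc t + 2 ^ suc t    ≡⟨ cong (2 ^ suc t +_) (+-identityʳ (2 ^ suc t)) ⟨
  2 ^ suc (suc t)          ∎
  where open ≤-Reasoning

sumBelow : (ℕ → ℕ) → ℕ → ℕ
sumBelow f zero    = 0
sumBelow f (suc K) = sumBelow f K + f K

sumBelow-≤ : ∀ f c B K → (∀ k → k < K → c * f k ≤ B) → c * sumBelow f K ≤ K * B
sumBelow-≤ f c B zero    _     = ≤-reflexive (*-zeroʳ c)
sumBelow-≤ f c B (suc K) bound = begin
  c * (sumBelow f K + f K)    ≡⟨ *-distribˡ-+ c (sumBelow f K) (f K) ⟩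
  c * sumBelow f K + c * f K  ≤⟨ +-mono-≤ (sumBelow-≤ f c B K (λ k k<K → bound k (m<n⇒m<1+n k<K))) (bound K ≤-refl) ⟩
  K * B + B                   ≡⟨ +-comm (K * B) B ⟩
  suc K * B                   ∎
  where open ≤-Reasoning

sumBelow-interval : ∀ f L R a x → (∀ i → a ≤ i → i < a + x → L * f i ≤ R) →
                    L * sumBelow f (a + x) ≤ L * sumBelow f a + x * R
sumBelow-interval f L R a zero _ = ≤-reflexive (trans (cong (λ n → L * sumBelow f n) (+-identityʳ a)) (sym (+-identityʳ _)))
sumBelow-interval f L R a (suc x) bound = begin
  L * sumBelow f (a + suc x)                   ≡⟨ cong (λ n → L * sumBelow f n) (+-suc a x) ⟩
  L * (sumBelow f (a + x) + f (a + x))          ≡⟨ *-distribˡ-+ L (sumBelow f (a + x)) (f (a + x)) ⟩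
  L * sumBelow f (a + x) + L * f (a + x)        ≤⟨ +-mono-≤ (sumBelow-interval f L R a x (λ i a≤i i<a+x → bound i a≤i (≤-trans i<a+x (+-monoʳ-≤ a (n≤1+n x)))))
                                                            (bound (a + x) (m≤m+n a x) (≤-reflexive (sym (+-suc a x)))) ⟩
  L * sumBelow f a + x * R + R                 ≡⟨ +-assoc (L * sumBelow f a) (x * R) R ⟩
  L * sumBelow f a + (x * R + R)               ≡⟨ cong (L * sumBelow f a +_) (+-comm (x * R) R) ⟩
  L * sumBelow f a + suc x * R                 ∎
  where open ≤-Reasoning

sumBelow-block : ∀ f L R a x .{{_ : NonZero L}} → x ≤ L → (∀ i → a ≤ i → i < a + x → L * f i ≤ R) →
                 sumBelow f (a + x) ≤ sumBelow f a + R
sumBelow-block f L R a x x≤L bound = *-cancelˡ-≤ L (begin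
  L * sumBelow f (a + x)        ≤⟨ sumBelow-interval f L R a x bound ⟩
  L * sumBelow f a + x * R      ≤⟨ +-monoʳ-≤ (L * sumBelow f a) (*-monoˡ-≤ R x≤L) ⟩
  L * sumBelow f a + L * R      ≡⟨ *-distribˡ-+ L (sumBelow f a) R ⟨
  L * (sumBelow f a + R)        ∎)
  where open ≤-Reasoning

pascal : ∀ n k → suc n C suc k ≡ n C k + n C suc k
pascal n k = sym (nCk+nC[k+1]≡[n+1]C[k+1] n k)

C-pos : ∀ n k → k ≤ n → 0 < n C k
C-pos n       zero    _         = z<s
C-pos (suc n) (suc k) (s≤s k≤n) = subst (0 <_) (sym (pascal n k)) (<-≤-trans (C-pos n k k≤n) (m≤m+n _ _))

absorption : ∀ n k → suc k * (suc n C suc k) ≡ suc n * (n C k)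
absorption zero    zero    = refl
absorption zero    (suc k) = trans (cong (suc (suc k) *_) (k>n⇒nCk≡0 {1} {suc (suc k)} (s≤s (s≤s z≤n)))) (*-zeroʳ (suc (suc k)))
absorption (suc n) zero    = trans (+-identityʳ _) (trans (nC1≡n (suc (suc n))) (sym (*-identityʳ (suc (suc n)))))
absorption (suc n) (suc k) = begin
  suc (suc k) * (suc (suc n) C suc (suc k))
    ≡⟨ cong (suc (suc k) *_) (pascal (suc n) (suc k)) ⟩
  suc (suc k) * (a + b)
    ≡⟨ regroup k a b ⟩
  suc k * a + a + suc (suc k) * b
    ≡⟨ cong₂ (λ x y → x + a + y) (absorption n k) (absorption n (suc k)) ⟩
  suc n * (n C k) + a + suc n * (n C suc k)
    ≡⟨ regroup′ (suc n) (n C k) (n C suc k) a ⟩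
  suc n * (n C k + n C suc k) + a
    ≡⟨ cong (λ x → suc n * x + a) (sym (pascal n k)) ⟩
  suc n * a + a
    ≡⟨ +-comm (suc n * a) a ⟩
  suc (suc n) * a ∎
  where
  open ≡-Reasoning
  a = suc n C suc k
  b = suc n C suc (suc k)
  regroup : ∀ k a b → suc (suc k) * (a + b) ≡ suc k * a + a + suc (suc k) * b
  regroup = solve-∀
  regroup′ : ∀ m x y a → m * x + a + m * y ≡ m * (x + y) + a
  regroup′ = solve-∀

sumBelow-pascal : ∀ n K → sumBelow (suc n C_) (suc K) ≡ sumBelow (n C_) (suc K) + sumBelow (n C_) K
sumBelow-pascal n zero    = refl
sumBelow-pascal n (suc K) = begin
  sumBelow (suc n C_) (suc K) + suc n C suc K
    ≡⟨ cong₂ _+_ (sumBelow-pascal n K) (pascal n K) ⟩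
  sumBelow (n C_) (suc K) + sumBelow (n C_) K + (n C K + n C suc K)
    ≡⟨ shuffle (sumBelow (n C_) (suc K)) (sumBelow (n C_) K) (n C K) (n C suc K) ⟩
  sumBelow (n C_) (suc K) + n C suc K + (sumBelow (n C_) K + n C K) ∎
  where
  open ≡-Reasoning
  shuffle : ∀ a b c d → a + b + (c + d) ≡ a + d + (b + c)
  shuffle = solve-∀

binomialRowSum : ∀ n → sumBelow (n C_) (suc n) ≡ 2 ^ n
binomialRowSum zero    = refl
binomialRowSum (suc n) = begin
  sumBelow (suc n C_) (suc (suc n))
    ≡⟨ sumBelow-pascal n (suc n) ⟩
  sumBelow (n C_) (suc n) + n C suc n + sumBelow (n C_) (suc n)
    ≡⟨ cong₂ (λ s z → s + z + s) (binomialRowSum n) (k>n⇒nCk≡0 (n<1+n n)) ⟩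
  2 ^ n + 0 + 2 ^ n
    ≡⟨ double (2 ^ n) ⟩
  2 ^ suc n ∎
  where
  open ≡-Reasoning
  double : ∀ x → x + 0 + x ≡ 2 * x
  double = solve-∀

-- If d₁ and d₂ = d₁ + e both divide A and d₁ d₂ = d₃ e (i.e. 1/d₃ = 1/d₁ - 1/d₂),
-- then d₃ divides A as well: A/d₃ = A/d₁ - A/d₂.
reciprocalDifference-∣ : ∀ A d₁ d₂ d₃ e .{{_ : NonZero e}} →
                         d₂ ≡ d₁ + e → d₁ * d₂ ≡ d₃ * e → d₁ ∣ A → d₂ ∣ A → d₃ ∣ A
reciprocalDifference-∣ A d₁ d₂ d₃ e d₂≡ product≡ d₁∣A d₂∣A = *-cancelʳ-∣ e (subst (_∣ A * e) product≡ d₁d₂∣Ae)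
  where
  d₁d₂∣Ad₂ : d₁ * d₂ ∣ A * d₂
  d₁d₂∣Ad₂ = *-monoˡ-∣ d₂ d₁∣A
  d₁d₂∣Ad₁ : d₁ * d₂ ∣ A * d₁
  d₁d₂∣Ad₁ = subst (d₁ * d₂ ∣_) (*-comm d₁ A) (*-monoʳ-∣ d₁ d₂∣A)
  Ad₂≡ : A * d₂ ≡ A * d₁ + A * e
  Ad₂≡ = trans (cong (A *_) d₂≡) (*-distribˡ-+ A d₁ e)
  d₁d₂∣Ae : d₁ * d₂ ∣ A * e
  d₁d₂∣Ae = ∣m+n∣m⇒∣n (subst (d₁ * d₂ ∣_) Ad₂≡ d₁d₂∣Ad₂) d₁d₂∣Ad₁

nair : ∀ A N → (∀ j → 1 ≤ j → j ≤ N → j ∣ A) → ∀ k n → k ≤ n → suc n ≤ N → suc n * (n C k) ∣ A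
nair A N allDivide zero    n       _         n<N = subst (_∣ A) (sym (*-identityʳ (suc n))) (allDivide (suc n) (s≤s z≤n) n<N)
nair A N allDivide (suc k) (suc n) (s≤s k≤n) n<N =
  reciprocalDifference-∣ A d₁ d₂ d₃ e {{e≢0}} d₂≡ product≡
    (nair A N allDivide k n k≤n (<⇒≤ n<N))
    (nair A N allDivide k (suc n) (m≤n⇒m≤1+n k≤n) n<N)
  where
  open ≡-Reasoning
  d₁ = suc n * (n C k)
  d₂ = suc (suc n) * (suc n C k)
  d₃ = suc (suc n) * (suc n C suc k)
  e  = suc k * (suc n C k)
  e≢0 : NonZero e
  e≢0 = m*n≢0 (suc k) (suc n C k) {{_}} {{>-nonZero (C-pos (suc n) k (m≤n⇒m≤1+n k≤n))}}
  d₂≡ : d₂ ≡ d₁ + e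
  d₂≡ = begin
    suc (suc n) * (suc n C k)                     ≡⟨ absorption (suc n) k ⟨
    suc k * (suc (suc n) C suc k)                 ≡⟨ cong (suc k *_) (pascal (suc n) k) ⟩
    suc k * (suc n C k + suc n C suc k)           ≡⟨ *-distribˡ-+ (suc k) (suc n C k) (suc n C suc k) ⟩
    e + suc k * (suc n C suc k)                   ≡⟨ cong (e +_) (absorption n k) ⟩
    e + d₁                                        ≡⟨ +-comm e d₁ ⟩
    d₁ + e                                        ∎
  product≡ : d₁ * d₂ ≡ d₃ * e
  product≡ = begin
    d₁ * d₂                                       ≡⟨ cong (_* d₂) (absorption n k) ⟨
    suc k * (suc n C suc k) * d₂                  ≡⟨ swap (suc k) (suc n C suc k) (suc (suc n)) (suc n C k) ⟩
    d₃ * e                                        ∎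
    where
    swap : ∀ a b c d → a * b * (c * d) ≡ c * b * (a * d)
    swap = solve-∀

-- Nair's bound: a positive common multiple of 1, 2, …, n + 1 is at least 2 ^ n.
-- Each of the n + 1 terms (n + 1) C(n,k) divides A, so (n + 1) 2 ^ n ≤ (n + 1) A.
commonMultiple-≥ : ∀ n A .{{_ : NonZero A}} → (∀ j → 1 ≤ j → j ≤ suc n → j ∣ A) → 2 ^ n ≤ A
commonMultiple-≥ n A allDivide = *-cancelˡ-≤ (suc n) (begin
  suc n * 2 ^ n                 ≡⟨ cong (suc n *_) (binomialRowSum n) ⟨
  suc n * sumBelow (n C_) (suc n) ≤⟨ sumBelow-≤ (n C_) (suc n) A (suc n) termBound ⟩
  suc n * A                     ∎)
  where
  open ≤-Reasoning
  termBound : ∀ k → k < suc n → suc n * (n C k) ≤ A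
  termBound k (s≤s k≤n) = ∣⇒≤ (nair A (suc n) allDivide k n k≤n ≤-refl)

SmoothOver : (ℕ → ℕ) → ℕ → ℕ → Set
SmoothOver q l j = ∀ p → Prime p → p ∣ j → ∃[ v ] (1 ≤ v × v ≤ l × q v ≡ p)

primeFree⇒∣1 : ∀ j .{{_ : NonZero j}} → (∀ p → Prime p → ¬ p ∣ j) → j ∣ 1
primeFree⇒∣1 j primeFree with factorise j
... | record { factors = []     ; isFactorisation = j≡1 } = ∣-reflexive j≡1
... | record { factors = p ∷ ps ; isFactorisation = j≡p*ps ; factorsPrime = p-prime ∷ _ } =
  contradiction (subst (p ∣_) (sym j≡p*ps) (m∣m*n (product ps))) (primeFree p p-prime)

splitPower : ∀ p .{{_ : NonTrivial p}} j .{{_ : NonZero j}} → ∃[ k ] ∃[ u ] (j ≡ p ^ k * u × ¬ p ∣ u)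
splitPower p j = go j (<-wellFounded j)
  where
  go : ∀ j .{{_ : NonZero j}} → Acc _<_ j → ∃[ k ] ∃[ u ] (j ≡ p ^ k * u × ¬ p ∣ u)
  go j (acc smaller) with p ∣? j
  ... | no p∤j = 0 , j , sym (*-identityˡ j) , p∤j
  ... | yes p∣j with go (quotient p∣j) {{quotient≢0 p∣j}} (smaller (quotient-< p∣j))
  ...   | k , u , quotient≡ , p∤u = suc k , u , (begin
          j                       ≡⟨ m∣n⇒n≡m*quotient p∣j ⟩
          p * quotient p∣j        ≡⟨ cong (p *_) quotient≡ ⟩
          p * (p ^ k * u)         ≡⟨ *-assoc p (p ^ k) u ⟨
          p ^ suc k * u           ∎) , p∤u
    where open ≡-Reasoning

smooth-shrink : ∀ q l {j u} → SmoothOver q (suc l) j → u ∣ j → ¬ q (suc l) ∣ u → SmoothOver q l u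
smooth-shrink q l smooth u∣j coprime p p-prime p∣u with smooth p p-prime (∣-trans p∣u u∣j)
... | v , 1≤v , v≤1+l , qv≡p with m≤n⇒m<n∨m≡n v≤1+l
...   | inj₁ (s≤s v≤l) = v , 1≤v , v≤l , qv≡p
...   | inj₂ refl = contradiction (subst (_∣ _) (sym qv≡p) p∣u) coprime

-- For primes q 1, …, q l and N ≥ 1 there is a common multiple A ≤ N ^ l of all j ≤ N that are
-- smooth over q 1, …, q l, namely A = ∏_{v ≤ l} q v ^ e_v with q v ^ e_v ≤ N < q v ^ (e_v + 1).
smoothMultiple : ∀ q N l → (∀ i → 1 ≤ i → i ≤ l → Prime (q i)) →
                 ∃[ A ] (0 < A × A ≤ suc N ^ l × (∀ j → 1 ≤ j → j ≤ suc N → SmoothOver q l j → j ∣ A))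
smoothMultiple q N zero _ = 1 , z<s , ≤-refl , divides1
  where
  divides1 : ∀ j → 1 ≤ j → j ≤ suc N → SmoothOver q 0 j → j ∣ 1
  divides1 j 1≤j _ smooth = primeFree⇒∣1 j {{>-nonZero 1≤j}} λ p p-prime p∣j →
    let (v , 1≤v , v≤0 , _) = smooth p p-prime p∣j in <⇒≱ 1≤v v≤0
smoothMultiple q N (suc l) primes with smoothMultiple q N l (λ i 1≤i i≤l → primes i 1≤i (m≤n⇒m≤1+n i≤l))
... | A , 0<A , A≤N^l , multiple = A * p ^ e , *-mono-< 0<A (m^n>0 p e) , bound , multiple′
  where
  p = q (suc l)
  instance
    p-nonTrivial : NonTrivial p
    p-nonTrivial = prime⇒nonTrivial (primes (suc l) (s≤s z≤n) ≤-refl)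
    p-nonZero : NonZero p
    p-nonZero = nonTrivial⇒nonZero p
  1<p : 1 < p
  1<p = nonTrivial⇒n>1 p
  e : ℕ
  e = proj₁ (floorLog p 1<p N)
  p^e≤N : p ^ e ≤ suc N
  p^e≤N = proj₁ (proj₂ (floorLog p 1<p N))
  N<p^e+1 : suc N < p ^ suc e
  N<p^e+1 = proj₂ (proj₂ (floorLog p 1<p N))
  bound : A * p ^ e ≤ suc N ^ suc l
  bound = ≤-trans (*-mono-≤ A≤N^l p^e≤N) (≤-reflexive (*-comm (suc N ^ l) (suc N)))
  -- write j = p ^ k · u with p ∤ u; then u ∣ A by induction and p ^ k ∣ p ^ e since p ^ k ≤ N.
  multiple′ : ∀ j → 1 ≤ j → j ≤ suc N → SmoothOver q (suc l) j → j ∣ A * p ^ e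
  multiple′ j 1≤j j≤N smooth with splitPower p j {{>-nonZero 1≤j}}
  ... | k , u , j≡ , p∤u = subst (_∣ A * p ^ e) (trans (*-comm u (p ^ k)) (sym j≡)) (*-pres-∣ u∣A p^k∣p^e)
    where
    instance _ = >-nonZero 1≤j
    u∣j : u ∣ j
    u∣j = divides (p ^ k) j≡
    p^k∣j : p ^ k ∣ j
    p^k∣j = divides u (trans j≡ (*-comm (p ^ k) u))
    u∣A : u ∣ A
    u∣A = multiple u 0<u (≤-trans (∣⇒≤ u∣j) j≤N) (smooth-shrink q l smooth u∣j p∤u)
      where
      0<u : 0 < u
      0<u = >-nonZero⁻¹ u {{m*n≢0⇒n≢0 (p ^ k) {{subst NonZero j≡ (>-nonZero 1≤j)}}}}
    p^k∣p^e : p ^ k ∣ p ^ e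
    p^k∣p^e = ^-monoʳ-∣ p {k} {e} (≤-pred (^-cancelʳ-< p 1<p (≤-<-trans (≤-trans (∣⇒≤ p^k∣j) j≤N) N<p^e+1)))

firstPrimes-mono : ∀ {r q} → FirstPrimes r q → ∀ {a b} → 1 ≤ a → a ≤ b → b ≤ r → q a ≤ q b
firstPrimes-mono (_ , increasing , _) {a} {b} 1≤a a≤b b≤r with m≤n⇒m<n∨m≡n a≤b
... | inj₁ a<b  = <⇒≤ (increasing a b 1≤a a<b b≤r)
... | inj₂ refl = ≤-refl

-- If the (k + 1)-st prime exceeds N + 1, all j ≤ N + 1 are smooth over the first k primes,
-- so Nair's bound applied to their common multiple from smoothMultiple gives 2 ^ N ≤ (N + 1) ^ k.
fewSmallPrimes : ∀ {r q} → FirstPrimes r q → ∀ k N → k < r → suc N < q (suc k) → 2 ^ N ≤ suc N ^ k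
fewSmallPrimes {r} {q} fp@(primes , _ , complete) k N k<r N<q with smoothMultiple q N k (λ i 1≤i i≤k → primes i 1≤i (≤-trans i≤k (<⇒≤ k<r)))
... | A , 0<A , A≤ , multiple = ≤-trans (commonMultiple-≥ N A {{>-nonZero 0<A}} allDivide) A≤
  where
  allDivide : ∀ j → 1 ≤ j → j ≤ suc N → j ∣ A
  allDivide j 1≤j j≤N = multiple j 1≤j j≤N smooth
    where
    divisor≤N : ∀ {d} → d ∣ j → d ≤ suc N
    divisor≤N d∣j = ≤-trans (∣⇒≤ {{>-nonZero 1≤j}} d∣j) j≤N
    smooth : SmoothOver q k j
    smooth p p-prime p∣j with complete p p-prime (<⇒≤ (≤-<-trans (divisor≤N p∣j) (≤-trans N<q (firstPrimes-mono fp (s≤s z≤n) k<r ≤-refl))))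
    ... | v , 1≤v , v≤r , qv≡p with v ≤? k
    ...   | yes v≤k = v , 1≤v , v≤k , qv≡p
    ...   | no v≰k  = contradiction (≤-trans (firstPrimes-mono fp (s≤s z≤n) (≰⇒> v≰k) v≤r) (≤-reflexive qv≡p))
                                    (<⇒≱ (≤-<-trans (divisor≤N p∣j) N<q))

gapArith : ∀ s Y k → s ≤ Y → 2 + k ≤ 2 * Y → 2 + suc s * k ≤ 2 * (Y * Y)
gapArith s (suc Z) k s≤Y k+2≤2Y = begin
  2 + suc s * k                  ≤⟨ +-monoʳ-≤ 2 (*-monoʳ-≤ (suc s) k≤2Z) ⟩
  2 + suc s * (2 * Z)            ≡⟨ expand s Z ⟩
  2 + 2 * Z + 2 * (s * Z)        ≤⟨ +-monoʳ-≤ (2 + 2 * Z) (*-monoʳ-≤ 2 (*-monoˡ-≤ Z s≤Y)) ⟩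
  2 + 2 * Z + 2 * (suc Z * Z)    ≡⟨ square Z ⟩
  2 * (suc Z * suc Z)            ∎
  where
  open ≤-Reasoning
  k≤2Z : k ≤ 2 * Z
  k≤2Z = +-cancelˡ-≤ 2 k (2 * Z) (≤-trans k+2≤2Y (≤-reflexive (*-suc 2 Z)))
  expand : ∀ s Z → 2 + suc s * (2 * Z) ≡ 2 + 2 * Z + 2 * (s * Z)
  expand = solve-∀
  square : ∀ Z → 2 + 2 * Z + 2 * (suc Z * Z) ≡ 2 * (suc Z * suc Z)
  square = solve-∀

-- Otherwise N = 2 ^ (2t + 1) would satisfy 2 ^ (N - 1) ≤ N ^ (i - 1) by fewSmallPrimes,
-- i.e. N ≤ 1 + (2t + 1)(i - 1), contradicting gapArith.
primeBound : ∀ {r q} → FirstPrimes r q → ∀ t i → 1 ≤ i → i ≤ r → i < 2 ^ suc t → q i ≤ 2 ^ suc (2 * t)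
primeBound {q = q} fp t (suc k) _ i≤r i<2^t+1 with q (suc k) ≤? 2 ^ suc (2 * t)
... | yes q≤ = q≤
... | no q≰ = contradiction (≤-pred (≤-trans tooBig (≤-trans (≤-reflexive (sym N≡)) N≤ck+1))) (1+n≰n {c * k})
  where
  c = suc (2 * t)
  N′ = pred (2 ^ c)
  N≡ : suc N′ ≡ 2 ^ c
  N≡ = suc-pred (2 ^ c) {{m^n≢0 2 c}}
  2^N′≤2^ck : 2 ^ N′ ≤ 2 ^ (c * k)
  2^N′≤2^ck = begin
    2 ^ N′          ≤⟨ fewSmallPrimes fp k N′ i≤r (subst (_< q (suc k)) (sym N≡) (≰⇒> q≰)) ⟩
    suc N′ ^ k      ≡⟨ cong (_^ k) N≡ ⟩
    (2 ^ c) ^ k     ≡⟨ ^-*-assoc 2 c k ⟩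
    2 ^ (c * k)     ∎
    where open ≤-Reasoning
  N≤ck+1 : suc N′ ≤ suc (c * k)
  N≤ck+1 = s≤s (≤-pred (^-cancelʳ-< 2 1<2 (≤-<-trans 2^N′≤2^ck (^-monoʳ-< 2 1<2 (n<1+n (c * k))))))
  tooBig : 2 + c * k ≤ 2 ^ c
  tooBig = begin
    2 + c * k                ≤⟨ gapArith (2 * t) (2 ^ t) k (double≤pow t) i<2^t+1 ⟩
    2 * (2 ^ t * 2 ^ t)      ≡⟨ cong (2 *_) (^-distribˡ-+-* 2 t t) ⟨
    2 * 2 ^ (t + t)          ≡⟨ cong (λ x → 2 * 2 ^ (t + x)) (+-identityʳ t) ⟨
    2 ^ c                    ∎
    where open ≤-Reasoning

-- Exponent of the bound q i ≤ 2 ^ (2 ⌊log₂ i⌋ + 1) for the i-th prime (primeBound).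
primeExponent : ℕ → ℕ
primeExponent i = suc (2 * ilog₂ i)

-- dyadicStart j = 1 + 2 + … + 2 ^ (j - 1) = 2 ^ j - 1: the dyadic block [2 ^ j, 2 ^ (j + 1)) of
-- positive integers consists of the numbers suc i with dyadicStart j ≤ i < dyadicStart (j + 1).
dyadicStart : ℕ → ℕ
dyadicStart zero    = 0
dyadicStart (suc j) = dyadicStart j + 2 ^ j

suc-dyadicStart : ∀ j → suc (dyadicStart j) ≡ 2 ^ j
suc-dyadicStart zero    = refl
suc-dyadicStart (suc j) = begin
  suc (dyadicStart j + 2 ^ j)    ≡⟨ cong (_+ 2 ^ j) (suc-dyadicStart j) ⟩
  2 ^ j + 2 ^ j                  ≡⟨ cong (2 ^ j +_) (+-identityʳ (2 ^ j)) ⟨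
  2 ^ suc j                      ∎
  where open ≡-Reasoning

-- The weights f i (attached to the integer suc i, for i < m) satisfy 2 ^ j · f i ≤ r (2j + 1)
-- on the dyadic block 2 ^ j ≤ suc i < 2 ^ (j + 1).
DyadicBound : (ℕ → ℕ) → ℕ → ℕ → Set
DyadicBound f r m = ∀ j i → 2 ^ j ≤ suc i → suc i < 2 ^ suc j → i < m → 2 ^ j * f i ≤ r * suc (2 * j)

-- Each dyadic block contributes at most r (2j + 1), so ∑_{i < m} f i ≤ r (J + 1)² for 2 ^ J ≤ m < 2 ^ (J + 1).
module DyadicSum (f : ℕ → ℕ) (r m : ℕ) (bound : DyadicBound f r m) where

  blockStep : ∀ j x → x ≤ 2 ^ j → dyadicStart j + x ≤ m →
              sumBelow f (dyadicStart j + x) ≤ sumBelow f (dyadicStart j) + r * suc (2 * j)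
  blockStep j x x≤2^j end≤m = sumBelow-block f (2 ^ j) (r * suc (2 * j)) (dyadicStart j) x {{m^n≢0 2 j}} x≤2^j inBlock
    where
    inBlock : ∀ i → dyadicStart j ≤ i → i < dyadicStart j + x → 2 ^ j * f i ≤ r * suc (2 * j)
    inBlock i start≤i i<end = bound j i (subst (_≤ suc i) (suc-dyadicStart j) (s≤s start≤i))
      (begin-strict
        suc i                      ≤⟨ i<end ⟩
        dyadicStart j + x          ≤⟨ +-monoʳ-≤ (dyadicStart j) x≤2^j ⟩
        dyadicStart (suc j)        <⟨ n<1+n _ ⟩
        suc (dyadicStart (suc j))  ≡⟨ suc-dyadicStart (suc j) ⟩
        2 ^ suc j                  ∎)
      (<-≤-trans i<end end≤m)
      where open ≤-Reasoning

  square-step : ∀ r j → r * (j * j) + r * suc (2 * j) ≡ r * (suc j * suc j)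
  square-step = solve-∀

  -- The complete blocks 0, …, j − 1 together contribute at most r (1 + 3 + … + (2j − 1)) = r j².
  prefixSum : ∀ j → dyadicStart j ≤ m → sumBelow f (dyadicStart j) ≤ r * (j * j)
  prefixSum zero    _     = z≤n
  prefixSum (suc j) end≤m = begin
    sumBelow f (dyadicStart j + 2 ^ j)          ≤⟨ blockStep j (2 ^ j) ≤-refl end≤m ⟩
    sumBelow f (dyadicStart j) + r * suc (2 * j) ≤⟨ +-monoˡ-≤ _ (prefixSum j (≤-trans (m≤m+n _ _) end≤m)) ⟩
    r * (j * j) + r * suc (2 * j)               ≡⟨ square-step r j ⟩
    r * (suc j * suc j)                         ∎
    where open ≤-Reasoning

  -- Blocks 0, …, J − 1 are complete and block J is partial.
  dyadicSum : ∀ J → 2 ^ J ≤ m → m < 2 ^ suc J → sumBelow f m ≤ r * (suc J * suc J)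
  dyadicSum J 2^J≤m m<2^J+1 = begin
    sumBelow f m                                ≡⟨ cong (sumBelow f) m≡ ⟨
    sumBelow f (dyadicStart J + x)              ≤⟨ blockStep J x x≤2^J (≤-reflexive m≡) ⟩
    sumBelow f (dyadicStart J) + r * suc (2 * J) ≤⟨ +-monoˡ-≤ _ (prefixSum J start≤m) ⟩
    r * (J * J) + r * suc (2 * J)               ≡⟨ square-step r J ⟩
    r * (suc J * suc J)                         ∎
    where
    open ≤-Reasoning
    start≤m : dyadicStart J ≤ m
    start≤m = <⇒≤ (subst (_≤ m) (sym (suc-dyadicStart J)) 2^J≤m)
    x = m ∸ dyadicStart J
    m≡ : dyadicStart J + x ≡ m
    m≡ = m+[n∸m]≡n start≤m
    x≤2^J : x ≤ 2 ^ J
    x≤2^J = +-cancelˡ-≤ (dyadicStart J) x (2 ^ J) (≤-pred (begin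
      suc (dyadicStart J + x)          ≡⟨ cong suc m≡ ⟩
      suc m                            ≤⟨ m<2^J+1 ⟩
      2 ^ suc J                        ≡⟨ suc-dyadicStart (suc J) ⟨
      suc (dyadicStart J + 2 ^ J)      ∎))

-- Under i h_i ≤ r, the weights h i (2 ⌊log₂ i⌋ + 1) satisfy the dyadic bound: on the block
-- 2 ^ j ≤ i < 2 ^ (j + 1) we have 2 ^ j h_i ≤ i h_i ≤ r and ⌊log₂ i⌋ ≤ j.
weights-dyadic : ∀ (h : ℕ → ℕ) r m → m ≤ r → (∀ i → 1 ≤ i → i ≤ r → i * h i ≤ r) →
                 DyadicBound (λ i → h (suc i) * primeExponent (suc i)) r m
weights-dyadic h r m m≤r ih≤r j i 2^j≤i i<2^j+1 i<m = begin
  2 ^ j * (h (suc i) * primeExponent (suc i))     ≡⟨ *-assoc (2 ^ j) (h (suc i)) _ ⟨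
  2 ^ j * h (suc i) * primeExponent (suc i)       ≤⟨ *-mono-≤ (≤-trans (*-monoˡ-≤ (h (suc i)) 2^j≤i) (ih≤r (suc i) (s≤s z≤n) (≤-trans i<m m≤r)))
                                                             (s≤s (*-monoʳ-≤ 2 log≤j)) ⟩
  r * suc (2 * j)                                 ∎
  where
  open ≤-Reasoning
  log≤j : ilog₂ (suc i) ≤ j
  log≤j = ≤-pred (^-cancelʳ-< 2 1<2 (≤-<-trans (ilog₂-lower (suc i) (s≤s z≤n)) i<2^j+1))

prodPow-lower : ∀ (q h : ℕ → ℕ) M → (∀ i → 1 ≤ i → i ≤ M → 2 ≤ q i ^ h i) → 2 ^ M ≤ prodPow q h M
prodPow-lower q h zero    _       = ≤-refl
prodPow-lower q h (suc M) factor≥ =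
  ≤-trans (≤-reflexive (*-comm 2 (2 ^ M)))
          (*-mono-≤ (prodPow-lower q h M (λ i 1≤i i≤M → factor≥ i 1≤i (m≤n⇒m≤1+n i≤M))) (factor≥ (suc M) (s≤s z≤n) ≤-refl))

prodPow-lower-strict : ∀ (q h : ℕ → ℕ) M → 2 ≤ M → (∀ i → 1 ≤ i → i ≤ M → 2 ≤ q i ^ h i) → 3 ≤ q 2 ^ h 2 →
                       2 ^ M < prodPow q h M
prodPow-lower-strict q h 0 () _ _
prodPow-lower-strict q h 1 (s≤s ()) _ _
prodPow-lower-strict q h 2 _ factor≥ third = begin-strict
  4                                    <⟨ n≤1+n 5 ⟩
  2 * 3                                ≤⟨ *-mono-≤ (prodPow-lower q h 1 (λ i 1≤i i≤1 → factor≥ i 1≤i (m≤n⇒m≤1+n i≤1))) third ⟩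
  prodPow q h 2                        ∎
  where open ≤-Reasoning
prodPow-lower-strict q h (suc M@(suc (suc _))) _ factor≥ third = begin-strict
  2 * 2 ^ M                            ≡⟨ *-comm 2 (2 ^ M) ⟩
  2 ^ M * 2                            <⟨ *-monoˡ-< 2 (prodPow-lower-strict q h M (s≤s (s≤s z≤n)) (λ i 1≤i i≤M → factor≥ i 1≤i (m≤n⇒m≤1+n i≤M)) third) ⟩
  prodPow q h M * 2                    ≤⟨ *-monoʳ-≤ (prodPow q h M) (factor≥ (suc M) (s≤s z≤n) ≤-refl) ⟩
  prodPow q h (suc M)                  ∎
  where open ≤-Reasoning

prodPow-upper : ∀ (q h b : ℕ → ℕ) M → (∀ i → 1 ≤ i → i ≤ M → q i ≤ 2 ^ b i) →
                prodPow q h M ≤ 2 ^ sumBelow (λ i → h (suc i) * b (suc i)) M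
prodPow-upper q h b zero    _       = ≤-refl
prodPow-upper q h b (suc M) q≤2^b = begin
  prodPow q h M * q (suc M) ^ h (suc M)
    ≤⟨ *-mono-≤ (prodPow-upper q h b M (λ i 1≤i i≤M → q≤2^b i 1≤i (m≤n⇒m≤1+n i≤M)))
                (^-monoˡ-≤ (h (suc M)) (q≤2^b (suc M) (s≤s z≤n) ≤-refl)) ⟩
  2 ^ E * (2 ^ b (suc M)) ^ h (suc M)
    ≡⟨ cong (2 ^ E *_) (^-*-assoc 2 (b (suc M)) (h (suc M))) ⟩
  2 ^ E * 2 ^ (b (suc M) * h (suc M))
    ≡⟨ cong (λ x → 2 ^ E * 2 ^ x) (*-comm (b (suc M)) (h (suc M))) ⟩
  2 ^ E * 2 ^ (h (suc M) * b (suc M))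
    ≡⟨ ^-distribˡ-+-* 2 E (h (suc M) * b (suc M)) ⟨
  2 ^ (E + h (suc M) * b (suc M))      ∎
  where
  open ≤-Reasoning
  E = sumBelow (λ i → h (suc i) * b (suc i)) M

witnessArith : ∀ r J → 2 ≤ r → 3 ≤ J → suc (r * (suc J * suc J)) * (8 * 8) < 2 * r * (pred (J * 8) * pred (J * 8)) * 1
witnessArith (suc (suc s)) (suc (suc (suc u))) (s≤s (s≤s z≤n)) (s≤s (s≤s (s≤s z≤n))) =
  ≤-trans (m≤m+n _ (128 * u * u + 448 * u + 3 + s * (64 * u * u + 224 * u + 34))) (≤-reflexive (expand s u))
  where
  expand : ∀ s u → suc (suc (suc (suc s) * ((4 + u) * (4 + u))) * (8 * 8))
                     + (128 * u * u + 448 * u + 3 + s * (64 * u * u + 224 * u + 34))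
                   ≡ 2 * suc (suc s) * ((23 + u * 8) * (23 + u * 8)) * 1
  expand = solve-∀

-- The rational witnesses for log₂ P < 2 r (log₂ m)² when log₂ P ≤ r (J + 1)², 2 ^ J ≤ m, J ≥ 3 and r ≥ 2:
-- a/b = (r (J + 1)² + 1)/1 exceeds log₂ P, c/d = (8J − 1)/8 is below J ≤ log₂ m, and a/b < 2 r (c/d)².
log2Witness : ∀ P r m J → 2 ≤ r → 3 ≤ J → 2 ^ J ≤ m → P ≤ 2 ^ (r * (suc J * suc J)) → Log2LtTwiceSqLog2 P r m
log2Witness P r m J 2≤r 3≤J 2^J≤m P≤ =
  suc A , 1 , pred (J * 8) , 8 , s≤s z≤n , s≤s z≤n , P^1<2^a , 2^c<m^8 , witnessArith r J 2≤r 3≤J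
  where
  A = r * (suc J * suc J)
  P^1<2^a : P ^ 1 < 2 ^ suc A
  P^1<2^a = begin-strict
    P ^ 1               ≡⟨ *-identityʳ P ⟩
    P                   ≤⟨ P≤ ⟩
    2 ^ A               <⟨ ^-monoʳ-< 2 1<2 (n<1+n A) ⟩
    2 ^ suc A           ∎
    where open ≤-Reasoning
  2^c<m^8 : 2 ^ pred (J * 8) < m ^ 8
  2^c<m^8 = begin-strict
    2 ^ pred (J * 8)    <⟨ ^-monoʳ-< 2 1<2 (≤-reflexive (suc-pred (J * 8) {{m*n≢0 J 8 {{>-nonZero (≤-trans (s≤s z≤n) 3≤J)}}}})) ⟩
    2 ^ (J * 8)         ≡⟨ ^-*-assoc 2 J 8 ⟨
    (2 ^ J) ^ 8         ≤⟨ ^-monoˡ-≤ 8 2^J≤m ⟩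
    m ^ 8               ∎
    where open ≤-Reasoning

lemma7p1 : (r : ℕ) (q h : ℕ → ℕ) → FirstPrimes r q →
    (∀ i → 1 ≤ i → i ≤ r → 1 ≤ h i × i * h i ≤ r) →
    (m : ℕ) → 10 < m → m ≤ r →
    LtLog2 m (prodPow q h m) × Log2LtTwiceSqLog2 (prodPow q h m) r m
lemma7p1 r q h fp@(primes , increasing , _) hyp m 10<m m≤r = lower , upper
  where
  2≤m : 2 ≤ m
  2≤m = ≤-trans (m≤n+m 2 9) 10<m
  q≥2 : ∀ i → 1 ≤ i → i ≤ r → 2 ≤ q i
  q≥2 i 1≤i i≤r = nonTrivial⇒n>1 (q i) {{prime⇒nonTrivial (primes i 1≤i i≤r)}}
  q≤factor : ∀ i → 1 ≤ i → i ≤ r → q i ≤ q i ^ h i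
  q≤factor i 1≤i i≤r = ≤-^ (q i) (h i) (proj₁ (hyp i 1≤i i≤r))
  q₂≥3 : 3 ≤ q 2
  q₂≥3 = ≤-trans (s≤s (q≥2 1 ≤-refl (≤-trans (s≤s z≤n) (≤-trans 2≤m m≤r)))) (increasing 1 2 ≤-refl ≤-refl (≤-trans 2≤m m≤r))
  lower : LtLog2 m (prodPow q h m)
  lower = prodPow-lower-strict q h m 2≤m
    (λ i 1≤i i≤m → ≤-trans (q≥2 i 1≤i (≤-trans i≤m m≤r)) (q≤factor i 1≤i (≤-trans i≤m m≤r)))
    (≤-trans q₂≥3 (q≤factor 2 (s≤s z≤n) (≤-trans 2≤m m≤r)))
  1≤m : 1 ≤ m
  1≤m = ≤-trans (s≤s z≤n) 2≤m
  J = ilog₂ m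
  3≤J : 3 ≤ J
  3≤J = ≤-pred (^-cancelʳ-< 2 1<2 (<-trans (≤-trans (m≤n+m 9 2) 10<m) (ilog₂-upper m 1≤m)))
  log₂P≤ : prodPow q h m ≤ 2 ^ (r * (suc J * suc J))
  log₂P≤ = ≤-trans
    (prodPow-upper q h primeExponent m (λ i 1≤i i≤m → primeBound fp (ilog₂ i) i 1≤i (≤-trans i≤m m≤r) (ilog₂-upper i 1≤i)))
    (^-monoʳ-≤ 2 (DyadicSum.dyadicSum _ r m (weights-dyadic h r m m≤r (λ i 1≤i i≤r → proj₂ (hyp i 1≤i i≤r)))
                                      J (ilog₂-lower m 1≤m) (ilog₂-upper m 1≤m)))
  upper : Log2LtTwiceSqLog2 (prodPow q h m) r m
  upper = log2Witness (prodPow q h m) r m J (≤-trans 2≤m m≤r) 3≤J (ilog₂-lower m 1≤m) log₂P≤
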